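{- Let $D$ be a diagram and $\tilde D=\mathcal{K}(D,r)$ for some $r\in\mathbb{Z}_{>0}$. Then $|\mathrm{empty}(D)|-1\le|\mathrm{empty}(\tilde D)|\le|\mathrm{empty}(D)|$. Moreover, if $\tilde D$ is formed from $D$ by moving the topmost cell in a column, then $|\mathrm{empty}(\tilde D)|=|\mathrm{empty}(D)|-1$.
   Context: A diagram is a finite subset $D\subset\mathbb{Z}_{>0}\times\mathbb{Z}_{>0}$; $(r,c)\in D$ is a cell in row $r$, column $c$. $\mathrm{empty}(D)=\{(r,c)\notin D : \exists\,\tilde r>r \text{ with } (\tilde r,c)\in D\}$. Kohnert move at row $r$: if row $r$ is empty, $\mathcal{K}(D,r)=D$; otherwise let $(r,c)$ be the rightmost cell of row $r$; if some $r'<r$ has $(r',c)\notin D$, take the largest such $r'$ and set $\mathcal{K}(D,r)=(D\setminus\{(r,c)\})\cup\{(r',c)\}$ (this moves the cell $(r,c)$); else $\mathcal{K}(D,r)=D$. -}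

module Defs where

open import Data.Nat using (ℕ; zero; suc; _≤_; _<_; _⊔_; _∸_; _≟_)
open import Data.Product using (_×_; _,_; proj₁; proj₂; ∃-syntax)
open import Data.Product.Properties using (≡-dec)
open import Data.List using (List; []; _∷_; map; filter; foldr; length)
open import Data.List.Membership.Propositional using (_∈_)
open import Data.List.Membership.DecPropositional (≡-dec _≟_ _≟_) using (_∈?_)
open import Data.List.Relation.Unary.All using (All)
open import Data.List.Relation.Unary.Unique.Propositional using (Unique)
open import Data.Maybe using (Maybe; just; nothing)
open import Relation.Binary.PropositionalEquality using (_≡_; _≢_)
open import Relation.Nullary using (¬_; yes; no; ¬?)
open import Function.Bundles using (_⇔_)

-- A cell (r , c) : row r, column c.
Cell : Set
Cell = ℕ × ℕ

-- A diagram is a finite set of cells, given by a list (duplicates irrelevant;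
-- the set is {x | x ∈ D}).
Diagram : Set
Diagram = List Cell

ValidDiagram : Diagram → Set
ValidDiagram D = All (λ x → 1 ≤ proj₁ x × 1 ≤ proj₂ x) D

Empty : Diagram → Cell → Set
Empty D (r , c) = 1 ≤ r × 1 ≤ c × ¬ ((r , c) ∈ D) × ∃[ r̃ ] (r < r̃ × (r̃ , c) ∈ D)

HasSize : (Cell → Set) → ℕ → Set
HasSize P k = ∃[ xs ] (Unique xs × (∀ x → (x ∈ xs ⇔ P x)) × length xs ≡ k)

rowCols : Diagram → ℕ → List ℕ
rowCols D r = map proj₂ (filter (λ x → proj₁ x ≟ r) D)

rightmost : Diagram → ℕ → Maybe ℕ
rightmost D r with rowCols D r
... | [] = nothing
... | cs = just (foldr _⊔_ 0 cs)

findSlot : Diagram → ℕ → ℕ → Maybe ℕ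
findSlot D c zero = nothing
findSlot D c (suc k) with (suc k , c) ∈? D
... | yes _ = findSlot D c k
... | no _ = just (suc k)

removeCell : Cell → Diagram → Diagram
removeCell x D = filter (λ y → ¬? (≡-dec _≟_ _≟_ y x)) D

kohnert : Diagram → ℕ → Diagram
kohnert D r with rightmost D r
... | nothing = D
... | just c with findSlot D c (r ∸ 1)
...   | nothing = D
...   | just r' = (r' , c) ∷ removeCell (r , c) D

Topmost : Diagram → Cell → Set
Topmost D (r , c) = (r , c) ∈ D × (∀ r̃ → (r̃ , c) ∈ D → r̃ ≤ r)

{-# OPTIONS --safe #-}
module Submission where

-- The move takes (r , c) to the highest free slot (r' , c) below it, and every cell strictly
-- between the two is occupied. So (r' , c), which was empty, becomes occupied; (r , c) is the only
-- cell that can become empty; and every other cell keeps its status, because a cell still has an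
-- occupied cell above it iff it had one before. This gives
--   empty(D) ⊆ {(r' , c)} ∪ empty(D')  and  {(r' , c)} ∪ empty(D') ⊆ {(r , c)} ∪ empty(D),
-- and if (r , c) was topmost in its column nothing lies above it afterwards, so even
--   {(r' , c)} ∪ empty(D') ⊆ empty(D).
-- Comparing sizes of these (disjoint) unions gives the bounds.

open import Defs
open import Data.Nat using (ℕ; suc; _≤_; _<_; _+_; _∸_; _≟_; _⊔_; z≤n; s≤s; s≤s⁻¹)
open import Data.Nat.Properties
  using ( ≤-refl; ≤-antisym; <-trans; <-cmp; <-asym; <⇒≱; +-comm; ⊔-identityʳ; ⊔-sel
        ; m≤n⇒m≤1+n; m≤n⇒m≤n+o; m≤n⇒m<n∨m≡n; module ≤-Reasoning)
open import Data.Product using (_×_; _,_; ∃-syntax; proj₁; proj₂)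
open import Data.Product.Properties using (≡-dec)
open import Data.Sum using (_⊎_; inj₁; inj₂; [_,_])
open import Data.Empty using (⊥-elim)
open import Data.Maybe using (just; nothing)
open import Data.List using (List; []; _∷_; filter; foldr; length)
open import Data.List.Properties using (filter-notAll)
open import Data.List.Membership.Propositional using (_∈_; _∉_)
open import Data.List.Membership.Propositional.Properties using (∈-filter⁺; ∈-filter⁻; ∈-map⁻)
open import Data.List.Membership.DecPropositional (≡-dec _≟_ _≟_) using (_∈?_)
import Data.List.Relation.Binary.Subset.Propositional as List
open import Data.List.Relation.Unary.Any as Any using (here; there)
open import Data.List.Relation.Unary.All as All using (All)
open import Data.List.Relation.Unary.AllPairs using (_∷_)
open import Data.List.Relation.Unary.Unique.Propositional using (Unique)
open import Function using (_∘_; id)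
open import Function.Bundles using (Equivalence; _⇔_; mk⇔)
open import Level using (Level)
open import Relation.Binary using (DecidableEquality; tri<; tri≈; tri>)
open import Relation.Binary.PropositionalEquality using (_≡_; _≢_; refl; sym; subst)
open import Relation.Nullary using (¬_; yes; no; ¬?)
open import Relation.Unary using (｛_｝; _∪_; _⊆_)

module _ {a : Level} {A : Set a} (_≟ᴬ_ : DecidableEquality A) where

  Unique-⊆⇒length≤ : ∀ {xs ys : List A} → Unique xs → xs List.⊆ ys → length xs ≤ length ys
  Unique-⊆⇒length≤ {[]} _ _ = z≤n
  Unique-⊆⇒length≤ {x ∷ xs} {ys} (x∉xs ∷ unique) x∷xs⊆ys = begin-strict
    length xs                          ≤⟨ Unique-⊆⇒length≤ unique xs⊆ys-x ⟩
    length (filter (¬? ∘ (_≟ᴬ x)) ys)  <⟨ filter-notAll _ ys (Any.map (λ x≡y y≢x → y≢x (sym x≡y)) x∈ys) ⟩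
    length ys                          ∎
    where
    open ≤-Reasoning
    x∈ys : x ∈ ys
    x∈ys = x∷xs⊆ys (here refl)
    xs⊆ys-x : xs List.⊆ filter (¬? ∘ (_≟ᴬ x)) ys
    xs⊆ys-x y∈xs = ∈-filter⁺ (¬? ∘ (_≟ᴬ x)) (x∷xs⊆ys (there y∈xs)) (λ y≡x → All.lookup x∉xs y∈xs (sym y≡x))

_≟ᶜ_ : DecidableEquality Cell
_≟ᶜ_ = ≡-dec _≟_ _≟_

HasSize-mono : ∀ {P Q : Cell → Set} {m n} → P ⊆ Q → HasSize P m → HasSize Q n → m ≤ n
HasSize-mono P⊆Q (xs , unique , xs⇔P , refl) (ys , _ , ys⇔Q , refl) =
  Unique-⊆⇒length≤ _≟ᶜ_ unique λ {x} x∈xs →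
    Equivalence.from (ys⇔Q x) (P⊆Q (Equivalence.to (xs⇔P x) x∈xs))

HasSize-insert : ∀ {P : Cell → Set} {x n} → ¬ P x → HasSize P n → HasSize (｛ x ｝ ∪ P) (suc n)
HasSize-insert {P} {x} ¬Px (xs , unique , xs⇔P , refl) = x ∷ xs , x∉xs ∷ unique , x∷xs⇔ , refl
  where
  x∉xs : All (x ≢_) xs
  x∉xs = All.tabulate λ {y} y∈xs x≡y → ¬Px (subst P (sym x≡y) (Equivalence.to (xs⇔P y) y∈xs))
  x∷xs⇔ : ∀ y → (y ∈ x ∷ xs) ⇔ (｛ x ｝ ∪ P) y
  x∷xs⇔ y = mk⇔ (λ { (here y≡x) → inj₁ (sym y≡x) ; (there y∈xs) → inj₂ (Equivalence.to (xs⇔P y) y∈xs) })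
                (λ { (inj₁ x≡y) → here (sym x≡y) ; (inj₂ Py) → there (Equivalence.from (xs⇔P y) Py) })

foldr-⊔-∈ : ∀ x xs → foldr _⊔_ 0 (x ∷ xs) ∈ x ∷ xs
foldr-⊔-∈ x [] = here (⊔-identityʳ x)
foldr-⊔-∈ x (y ∷ ys) with ⊔-sel x (foldr _⊔_ 0 (y ∷ ys))
... | inj₁ max≡x = here max≡x
... | inj₂ max≡rest = there (subst (_∈ y ∷ ys) (sym max≡rest) (foldr-⊔-∈ y ys))

rowCols-∈ : ∀ {D r c} → c ∈ rowCols D r → (r , c) ∈ D
rowCols-∈ {D} {r} c∈row with ∈-map⁻ proj₂ c∈row
... | _ , x∈row , refl with ∈-filter⁻ (λ x → proj₁ x ≟ r) {xs = D} x∈row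
...   | x∈D , refl = x∈D

rightmost-∈ : ∀ D r {c} → rightmost D r ≡ just c → (r , c) ∈ D
rightmost-∈ D r eq with rowCols D r in row
rightmost-∈ D r () | []
rightmost-∈ D r refl | x ∷ xs = rowCols-∈ (subst (_ ∈_) (sym row) (foldr-⊔-∈ x xs))

findSlot-∉ : ∀ {D c} k {r'} → findSlot D c k ≡ just r' → (r' , c) ∉ D
findSlot-∉ {D} {c} (suc k) eq with (suc k , c) ∈? D
... | yes _ = findSlot-∉ k eq
findSlot-∉ (suc k) refl | no ∉D = ∉D

findSlot-positive : ∀ {D c} k {r'} → findSlot D c k ≡ just r' → 1 ≤ r'
findSlot-positive {D} {c} (suc k) eq with (suc k , c) ∈? D
... | yes _ = findSlot-positive k eq
findSlot-positive (suc k) refl | no _ = s≤s z≤n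

findSlot-≤ : ∀ {D c} k {r'} → findSlot D c k ≡ just r' → r' ≤ k
findSlot-≤ {D} {c} (suc k) eq with (suc k , c) ∈? D
... | yes _ = m≤n⇒m≤1+n (findSlot-≤ k eq)
findSlot-≤ (suc k) refl | no _ = ≤-refl

findSlot-above : ∀ {D c} k {r' j} → findSlot D c k ≡ just r' → r' < j → j ≤ k → (j , c) ∈ D
findSlot-above {D} {c} (suc k) eq r'<j j≤1+k with (suc k , c) ∈? D
... | yes 1+k∈D with m≤n⇒m<n∨m≡n j≤1+k
...   | inj₁ j<1+k = findSlot-above k eq r'<j (s≤s⁻¹ j<1+k)
...   | inj₂ refl = 1+k∈D
findSlot-above (suc k) refl r'<j j≤1+k | no _ = ⊥-elim (<⇒≱ r'<j j≤1+k)

moveCell : Cell → Cell → Diagram → Diagram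
moveCell x y D = y ∷ removeCell x D

∈-moveCell⁺ : ∀ {x y z D} → z ∈ D → z ≢ x → z ∈ moveCell x y D
∈-moveCell⁺ {x} z∈D z≢x = there (∈-filter⁺ (λ w → ¬? (w ≟ᶜ x)) z∈D z≢x)

∈-moveCell⁻ : ∀ {x y z D} → z ∈ moveCell x y D → z ≡ y ⊎ z ∈ D
∈-moveCell⁻ (here z≡y) = inj₁ z≡y
∈-moveCell⁻ {x} {D = D} (there z∈D-x) = inj₂ (proj₁ (∈-filter⁻ (λ w → ¬? (w ≟ᶜ x)) {xs = D} z∈D-x))

record KohnertMoves (D : Diagram) (r c r' : ℕ) : Set where
  constructor moves
  field
    rightmost≡ : rightmost D r ≡ just c
    findSlot≡  : findSlot D c (r ∸ 1) ≡ just r'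

kohnert-cases : ∀ D r → kohnert D r ≡ D ⊎ ∃[ c ] ∃[ r' ] KohnertMoves D r c r'
kohnert-cases D r with rightmost D r in p
... | nothing = inj₁ refl
... | just c with findSlot D c (r ∸ 1) in q
...   | nothing = inj₁ refl
...   | just r' = inj₂ (c , r' , moves p q)

kohnert-moves : ∀ {D r c r'} → KohnertMoves D r c r' → kohnert D r ≡ moveCell (r , c) (r' , c) D
kohnert-moves (moves p q) rewrite p | q = refl

record Drop (D : Diagram) (r c r' : ℕ) : Set where
  field
    1≤c      : 1 ≤ c
    1≤r'     : 1 ≤ r'
    r'<r     : r' < r
    source∈  : (r , c) ∈ D
    target∉  : (r' , c) ∉ D
    between∈ : ∀ {j} → r' < j → j < r → (j , c) ∈ D

KohnertMoves⇒Drop : ∀ {D r c r'} → ValidDiagram D → 1 ≤ r → KohnertMoves D r c r' → Drop D r c r'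
KohnertMoves⇒Drop {D} {suc k} valid (s≤s z≤n) (moves p q) = record
  { 1≤c      = proj₂ (All.lookup valid (rightmost-∈ D (suc k) p))
  ; 1≤r'     = findSlot-positive k q
  ; r'<r     = s≤s (findSlot-≤ k q)
  ; source∈  = rightmost-∈ D (suc k) p
  ; target∉  = findSlot-∉ k q
  ; between∈ = λ r'<j j<r → findSlot-above k q r'<j (s≤s⁻¹ j<r)
  }

Above : Diagram → Cell → Set
Above D (a , b) = ∃[ t ] (a < t × (t , b) ∈ D)

∈⇒¬Empty : ∀ {D x} → x ∈ D → ¬ Empty D x
∈⇒¬Empty x∈D (_ , _ , x∉D , _) = x∉D x∈D

module _ {D r c r'} (drop : Drop D r c r') where
  open Drop drop

  private
    D' : Diagram
    D' = moveCell (r , c) (r' , c) D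

  Above-moved⇒Above : ∀ {x} → Above D' x → Above D x
  Above-moved⇒Above {a , b} (t , a<t , t∈D') with ∈-moveCell⁻ t∈D'
  ... | inj₁ refl = r , <-trans a<t r'<r , source∈
  ... | inj₂ t∈D  = t , a<t , t∈D

  Above⇒Above-moved : ∀ {x} → x ∉ D → x ≢ (r' , c) → Above D x → Above D' x
  Above⇒Above-moved {a , b} x∉D x≢target (t , a<t , t∈D) with (t , b) ≟ᶜ (r , c)
  ... | no ≢source = t , a<t , ∈-moveCell⁺ t∈D ≢source
  ... | yes refl with <-cmp a r'
  ...   | tri< a<r' _ _ = r' , a<r' , here refl
  ...   | tri≈ _ refl _ = ⊥-elim (x≢target refl)
  ...   | tri> _ _ r'<a = ⊥-elim (x∉D (between∈ r'<a a<t))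

  Empty-target : Empty D (r' , c)
  Empty-target = 1≤r' , 1≤c , target∉ , r , r'<r , source∈

  Empty⊆Empty-moved : Empty D ⊆ ｛ (r' , c) ｝ ∪ Empty D'
  Empty⊆Empty-moved {a , b} (1≤a , 1≤b , x∉D , above) with (r' , c) ≟ᶜ (a , b)
  ... | yes target≡x = inj₁ target≡x
  ... | no target≢x = inj₂ (1≤a , 1≤b , x∉D' , Above⇒Above-moved x∉D x≢target above)
    where
    x≢target : (a , b) ≢ (r' , c)
    x≢target = target≢x ∘ sym
    x∉D' : (a , b) ∉ D'
    x∉D' x∈D' = [ x≢target , x∉D ] (∈-moveCell⁻ x∈D')

  Empty-moved⊆Empty : Empty D' ⊆ ｛ (r , c) ｝ ∪ Empty D
  Empty-moved⊆Empty {a , b} (1≤a , 1≤b , x∉D' , above) with (r , c) ≟ᶜ (a , b)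
  ... | yes source≡x = inj₁ source≡x
  ... | no source≢x = inj₂ (1≤a , 1≤b , x∉D , Above-moved⇒Above above)
    where
    x∉D : (a , b) ∉ D
    x∉D x∈D = x∉D' (∈-moveCell⁺ x∈D (source≢x ∘ sym))

  ¬Empty-moved-source : (∀ s → (s , c) ∈ D → s ≤ r) → ¬ Empty D' (r , c)
  ¬Empty-moved-source top (_ , _ , _ , t , r<t , t∈D') with ∈-moveCell⁻ t∈D'
  ... | inj₁ refl = <-asym r<t r'<r
  ... | inj₂ t∈D  = <⇒≱ r<t (top t t∈D)

  target∪Empty-moved⊆source∪Empty : ｛ (r' , c) ｝ ∪ Empty D' ⊆ ｛ (r , c) ｝ ∪ Empty D
  target∪Empty-moved⊆source∪Empty (inj₁ refl)   = inj₂ Empty-target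
  target∪Empty-moved⊆source∪Empty (inj₂ empty') = Empty-moved⊆Empty empty'

  target∪Empty-moved⊆Empty : (∀ s → (s , c) ∈ D → s ≤ r) → ｛ (r' , c) ｝ ∪ Empty D' ⊆ Empty D
  target∪Empty-moved⊆Empty top (inj₁ refl) = Empty-target
  target∪Empty-moved⊆Empty top (inj₂ empty') with Empty-moved⊆Empty empty'
  ... | inj₁ refl  = ⊥-elim (¬Empty-moved-source top empty')
  ... | inj₂ empty = empty

  HasSize-target∪Empty-moved : ∀ {e'} → HasSize (Empty D') e' → HasSize (｛ (r' , c) ｝ ∪ Empty D') (suc e')
  HasSize-target∪Empty-moved = HasSize-insert (∈⇒¬Empty (here refl))

  Empty-size-bounds : ∀ {e e'} → HasSize (Empty D) e → HasSize (Empty D') e' → e ≤ e' + 1 × e' ≤ e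
  Empty-size-bounds {e} {e'} size size' =
      subst (e ≤_) (+-comm 1 e') (HasSize-mono Empty⊆Empty-moved size (HasSize-target∪Empty-moved size'))
    , s≤s⁻¹ (HasSize-mono target∪Empty-moved⊆source∪Empty
               (HasSize-target∪Empty-moved size') (HasSize-insert (∈⇒¬Empty source∈) size))

  Empty-size-topmost : ∀ {e e'} → (∀ s → (s , c) ∈ D → s ≤ r) →
                       HasSize (Empty D) e → HasSize (Empty D') e' → e' + 1 ≡ e
  Empty-size-topmost {e} {e'} top size size' = ≤-antisym
    (subst (_≤ e) (+-comm 1 e') (HasSize-mono (target∪Empty-moved⊆Empty top) (HasSize-target∪Empty-moved size') size))
    (proj₁ (Empty-size-bounds size size'))

lemma4p7 : (D : Diagram) → ValidDiagram D → (r : ℕ) → 1 ≤ r →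
    (e e' : ℕ) → HasSize (Empty D) e → HasSize (Empty (kohnert D r)) e' →
    (e ≤ e' + 1 × e' ≤ e)
    × ((c r' : ℕ) → rightmost D r ≡ just c → findSlot D c (r ∸ 1) ≡ just r' →
       Topmost D (r , c) → e' + 1 ≡ e)
lemma4p7 D valid r 1≤r e e' size size' = bounds (kohnert-cases D r) , topmost
  where
  size-after : ∀ {D'} → kohnert D r ≡ D' → HasSize (Empty D') e'
  size-after eq = subst (λ D' → HasSize (Empty D') e') eq size'

  bounds : kohnert D r ≡ D ⊎ ∃[ c ] ∃[ r' ] KohnertMoves D r c r' → e ≤ e' + 1 × e' ≤ e
  bounds (inj₁ unchanged) =
    m≤n⇒m≤n+o 1 (HasSize-mono id size (size-after unchanged)) , HasSize-mono id (size-after unchanged) size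
  bounds (inj₂ (_ , _ , move)) =
    Empty-size-bounds (KohnertMoves⇒Drop valid 1≤r move) size (size-after (kohnert-moves move))

  topmost : (c r' : ℕ) → rightmost D r ≡ just c → findSlot D c (r ∸ 1) ≡ just r' →
            Topmost D (r , c) → e' + 1 ≡ e
  topmost c r' p q (_ , top) =
    Empty-size-topmost (KohnertMoves⇒Drop valid 1≤r move) top size (size-after (kohnert-moves move))
    where
    move : KohnertMoves D r c r'
    move = moves p q
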